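{- For every nonzero rational $u$, let $p = u(u^2+1)$, $q = 3(u^2+2)$, $r = 3u$, $s = u^2(u^2+4)$ and $a = \frac{u^2+2}{u^4}$. Then $pq(p^2+q^2) = a\,rs(r^2+s^2)$; equivalently $A=p+q$, $B=r-s$, $C=p-q$, $D=r+s$ satisfy $A^4 + aB^4 = C^4 + aD^4$. -}

module Defs where

open import Data.Rational using (ℚ; 0ℚ; 1ℚ; _+_; _-_; _*_; 1/_; ≢-nonZero)
open import Relation.Binary.PropositionalEquality using (_≢_)

sq : ℚ → ℚ
sq x = x * x

pow4 : ℚ → ℚ
pow4 x = sq (sq x)

2ℚ 3ℚ 4ℚ : ℚ
2ℚ = 1ℚ + 1ℚ
3ℚ = 2ℚ + 1ℚ
4ℚ = 3ℚ + 1ℚ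

pP qP rP sP : ℚ → ℚ
pP u = u * (sq u + 1ℚ)
qP u = 3ℚ * (sq u + 2ℚ)
rP u = 3ℚ * u
sP u = sq u * (sq u + 4ℚ)

aP : (u : ℚ) → u ≢ 0ℚ → ℚ
aP u u≢0 = (sq u + 2ℚ) * pow4 (1/_ u {{≢-nonZero u≢0}})

module Submission where

-- Write X(x, y) = x y (x² + y²).  The proof rests on two polynomial facts.
--
--  * The binomial theorem gives (x + y)⁴ − (x − y)⁴ = 8 X(x, y).  Hence any
--    relation X(p, q) = a X(r, s) transfers to the quartic relation
--    (p + q)⁴ + a (r − s)⁴ = (p − q)⁴ + a (r + s)⁴: both sides differ from
--    (p − q)⁴ + a (r − s)⁴ by 8 X(p, q) = 8 a X(r, s).
--
--  * For the parametrisation p, q, r, s of the theorem, the first relation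
--    holds with denominators cleared: u⁴ X(p, q) = (u² + 2) X(r, s), an
--    identity of polynomials in u checked by ring normalisation.
--
-- Dividing the cleared identity by u⁴ (multiplying by (1/u)⁴, using
-- u · (1/u) = 1) yields X(p, q) = a X(r, s) with a = (u² + 2)/u⁴, which is
-- the first claim; the transfer lemma then gives the second.

open import Defs
open import Data.Rational using (ℚ; 0ℚ; 1ℚ; _+_; _-_; _*_; 1/_; ≢-nonZero)
open import Data.Rational.Properties using (*-inverseʳ)
open import Data.Rational.Solver using (module +-*-Solver)
open import Data.Product using (_×_; _,_)
open import Relation.Binary.PropositionalEquality using (_≡_; _≢_; refl; sym; cong; module ≡-Reasoning)

open +-*-Solver
open ≡-Reasoning

X : ℚ → ℚ → ℚ
X x y = x * y * (sq x + sq y)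

8ℚ : ℚ
8ℚ = 4ℚ + 4ℚ

-- Solver-syntax versions of sq, pow4 and X; they denote sq, pow4 and X
-- definitionally, so solver goals match the statements below verbatim.
sq′ : ∀ {n} → Polynomial n → Polynomial n
sq′ x = x :* x

pow4′ : ∀ {n} → Polynomial n → Polynomial n
pow4′ x = sq′ (sq′ x)

X′ : ∀ {n} → Polynomial n → Polynomial n → Polynomial n
X′ x y = x :* y :* (sq′ x :+ sq′ y)

quartic-difference : ∀ x y → pow4 (x + y) ≡ pow4 (x - y) + 8ℚ * X x y
quartic-difference = solve 2
  (λ x y → pow4′ (x :+ y) := pow4′ (x :- y) :+ con 8ℚ :* X′ x y) refl

quartic-transfer : ∀ p q r s a → X p q ≡ a * X r s →
  pow4 (p + q) + a * pow4 (r - s) ≡ pow4 (p - q) + a * pow4 (r + s)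
quartic-transfer p q r s a h = begin
  pow4 (p + q) + a * pow4 (r - s)
    ≡⟨ cong (_+ a * pow4 (r - s)) (quartic-difference p q) ⟩
  pow4 (p - q) + 8ℚ * X p q + a * pow4 (r - s)
    ≡⟨ cong (λ t → pow4 (p - q) + 8ℚ * t + a * pow4 (r - s)) h ⟩
  pow4 (p - q) + 8ℚ * (a * X r s) + a * pow4 (r - s)
    ≡⟨ regroup (pow4 (p - q)) a (X r s) (pow4 (r - s)) ⟩
  pow4 (p - q) + a * (pow4 (r - s) + 8ℚ * X r s)
    ≡⟨ cong (λ t → pow4 (p - q) + a * t) (sym (quartic-difference r s)) ⟩
  pow4 (p - q) + a * pow4 (r + s) ∎
  where
  regroup : ∀ c a y b → c + 8ℚ * (a * y) + a * b ≡ c + a * (b + 8ℚ * y)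
  regroup = solve 4
    (λ c a y b → c :+ con 8ℚ :* (a :* y) :+ a :* b := c :+ a :* (b :+ con 8ℚ :* y)) refl

cleared-identity : ∀ u → pow4 u * X (pP u) (qP u) ≡ (sq u + 2ℚ) * X (rP u) (sP u)
cleared-identity = solve 1 (λ u →
  let p = u :* (sq′ u :+ con 1ℚ)
      q = con 3ℚ :* (sq′ u :+ con 2ℚ)
      r = con 3ℚ :* u
      s = sq′ u :* (sq′ u :+ con 4ℚ)
  in pow4′ u :* X′ p q := (sq′ u :+ con 2ℚ) :* X′ r s) refl

cancel-pow4 : ∀ u v x c y → u * v ≡ 1ℚ → pow4 u * x ≡ c * y → x ≡ (c * pow4 v) * y
cancel-pow4 u v x c y uv≡1 h = begin
  x                       ≡⟨ times-pow4-one x ⟩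
  x * pow4 1ℚ             ≡⟨ cong (λ t → x * pow4 t) (sym uv≡1) ⟩
  x * pow4 (u * v)        ≡⟨ regroup x u v ⟩
  pow4 v * (pow4 u * x)   ≡⟨ cong (pow4 v *_) h ⟩
  pow4 v * (c * y)        ≡⟨ reassociate (pow4 v) c y ⟩
  (c * pow4 v) * y        ∎
  where
  times-pow4-one : ∀ x → x ≡ x * pow4 1ℚ
  times-pow4-one = solve 1 (λ x → x := x :* pow4′ (con 1ℚ)) refl
  regroup : ∀ x u v → x * pow4 (u * v) ≡ pow4 v * (pow4 u * x)
  regroup = solve 3 (λ x u v → x :* pow4′ (u :* v) := pow4′ v :* (pow4′ u :* x)) refl
  reassociate : ∀ w c y → w * (c * y) ≡ (c * w) * y
  reassociate = solve 3 (λ w c y → w :* (c :* y) := (c :* w) :* y) refl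

mainTheorem10 : (u : ℚ) → (u≢0 : u ≢ 0ℚ) →
    (pP u * qP u * (sq (pP u) + sq (qP u)) ≡ aP u u≢0 * (rP u * sP u * (sq (rP u) + sq (sP u))))
    × (pow4 (pP u + qP u) + aP u u≢0 * pow4 (rP u - sP u) ≡ pow4 (pP u - qP u) + aP u u≢0 * pow4 (rP u + sP u))
mainTheorem10 u u≢0 = first-claim , quartic-transfer (pP u) (qP u) (rP u) (sP u) (aP u u≢0) first-claim
  where
  instance _ = ≢-nonZero u≢0
  first-claim : X (pP u) (qP u) ≡ aP u u≢0 * X (rP u) (sP u)
  first-claim = cancel-pow4 u (1/ u) _ (sq u + 2ℚ) _ (*-inverseʳ u) (cleared-identity u)
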